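{- Let $R_n$ be the graph with vertex set $\{(i,j,k):1\le i,j,k\le n\}$ in which two distinct vertices $(i_1,j_1,k_1)$ and $(i_2,j_2,k_2)$ are adjacent iff $|i_1-i_2|\le1$, $|j_1-j_2|\le1$ and $|k_1-k_2|\le1$, and let $\mathcal{R}=\{R_n:n\ge1\}$. Then $\mathcal{R}$ is fractionally $\mathrm{Vs}$-fragile.
   Context: A class property is a class of graph classes. $\mathrm{Vs}$ is the class property consisting of all graph classes $\mathcal{C}$ with bounded component size, i.e. for which there is $t\ge0$ such that every connected component of every graph in $\mathcal{C}$ has at most $t$ vertices. For a graph $G$ and a graph class $\mathcal{C}$, let $G-\mathcal{C}=\{X\subseteq V(G): G-X\in\mathcal{C}\}$. A fractional $\mathcal{C}$-complementary packing in $G$ is a map $\pi:G-\mathcal{C}\to[0,1]$ with $\sum_{X\in G-\mathcal{C}}\pi(X)=1$; its thickness is $\max_{v\in V(G)}\sum_{X\in G-\mathcal{C},\,v\in X}\pi(X)$. A class $\mathcal{G}$ is fractionally $\mathcal{P}$-fragile (for a class property $\mathcal{P}$) if for every $\varepsilon>0$ there exists a class $\mathcal{C}\in\mathcal{P}$ such that every graph in $\mathcal{G}$ has a fractional $\mathcal{C}$-complementary packing of thickness at most $\varepsilon$.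
   Formalization: The threshold ε ranges over the positive rationals, and the weights of each fractional complementary packing are taken in the rationals. -}

module Defs where

open import Level using () renaming (suc to lsuc; zero to lzero)
open import Data.Nat using (ℕ; _≤_) renaming (∣_-_∣ to dist)
open import Data.Fin using (Fin; toℕ)
open import Data.Bool using (Bool; true; false)
open import Data.Product using (Σ; _×_; _,_; proj₁)
open import Data.Sum using (_⊎_)
open import Data.List using (List; []; _∷_; length)
open import Data.List.Membership.Propositional using (_∈_)
open import Data.List.Relation.Unary.All using (All)
open import Data.List.Relation.Unary.Unique.Propositional using (Unique)
open import Relation.Binary.PropositionalEquality using (_≡_)
open import Relation.Nullary using (¬_)
open import Data.Rational as ℚ using (ℚ; 0ℚ; 1ℚ)

record Graph : Set₁ where
  field
    V : Set
    E : V → V → Set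
open Graph public

GraphClass : Set₂
GraphClass = Graph → Set₁

ClassProperty : Set₂
ClassProperty = GraphClass → Set₁

VSubset : Graph → Set
VSubset G = V G → Bool

_─_ : (G : Graph) → VSubset G → Graph
G ─ X = record
  { V = Σ (V G) (λ v → X v ≡ false)
  ; E = λ u w → E G (proj₁ u) (proj₁ w) }

data Reach (G : Graph) : V G → V G → Set where
  here : ∀ {v} → Reach G v v
  step : ∀ {u w v} → (E G u w ⊎ E G w u) → Reach G w v → Reach G u v

ComponentsAtMost : ℕ → Graph → Set
ComponentsAtMost t G =
  (v : V G) (xs : List (V G)) → Unique xs → All (Reach G v) xs → length xs ≤ t

Vs : ClassProperty
Vs 𝒞 = Σ ℕ λ t → (G : Graph) → 𝒞 G → ComponentsAtMost t G

sumℚ : List ℚ → ℚ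
sumℚ [] = 0ℚ
sumℚ (q ∷ qs) = q ℚ.+ sumℚ qs

record WeightedSet (𝒞 : GraphClass) (G : Graph) : Set₁ where
  field
    set    : VSubset G
    inC    : 𝒞 (G ─ set)
    weight : ℚ
    w≥0    : 0ℚ ℚ.≤ weight
    w≤1    : weight ℚ.≤ 1ℚ
open WeightedSet public

weights : ∀ {𝒞 G} → List (WeightedSet 𝒞 G) → List ℚ
weights [] = []
weights (x ∷ xs) = weight x ∷ weights xs

load : ∀ {𝒞 G} → List (WeightedSet 𝒞 G) → V G → ℚ
load [] v = 0ℚ
load (x ∷ xs) v with set x v
... | true  = weight x ℚ.+ load xs v
... | false = load xs v

FracPacking : GraphClass → Graph → ℚ → Set₁
FracPacking 𝒞 G ε =
  Σ (List (WeightedSet 𝒞 G)) λ π →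
    (sumℚ (weights π) ≡ 1ℚ) × ((v : V G) → load π v ℚ.≤ ε)

FractionallyFragile : ClassProperty → GraphClass → Set₂
FractionallyFragile 𝒫 𝒢 =
  (ε : ℚ) → 0ℚ ℚ.< ε →
  Σ GraphClass λ 𝒞 → 𝒫 𝒞 × ((G : Graph) → 𝒢 G → FracPacking 𝒞 G ε)

-- The graph R_n (vertices (i,j,k), 1 ≤ i,j,k ≤ n, indexed by Fin n).
R : ℕ → Graph
R n = record
  { V = Fin n × Fin n × Fin n
  ; E = λ { (i₁ , j₁ , k₁) (i₂ , j₂ , k₂) →
        ¬ ((i₁ , j₁ , k₁) ≡ (i₂ , j₂ , k₂)) ×
        dist (toℕ i₁) (toℕ i₂) ≤ 1 ×
        dist (toℕ j₁) (toℕ j₂) ≤ 1 ×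
        dist (toℕ k₁) (toℕ k₂) ≤ 1 } }

ℛ : GraphClass
ℛ G = Σ ℕ λ n → (1 ≤ n) × (G ≡ R n)

module Submission where

-- Fix m and, for each shift s < m, delete every vertex of R_n having a coordinate x with m ∣ x + s. Two
-- surviving adjacent vertices lie in the same block of the grid {(x + s) / m = const}³, so the surviving
-- components have at most m³ vertices. Each coordinate value is deleted by exactly one shift, so every vertex is
-- deleted by at most three of the m shifts: weighting each shift by 1/m gives a packing of thickness 3/m, which
-- is at most ε once m = 3 · denominator ε.

open import Defs
open import Data.Bool using (Bool; true; false; _∨_)
open import Data.Bool.Properties using () renaming (_≟_ to _≟ᵇ_)
open import Data.Fin using (Fin; toℕ; fromℕ<; combine)
open import Data.Fin.Properties using (toℕ-fromℕ<; toℕ-injective; combine-injective; injective⇒≤)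
open import Data.Integer as ℤ using (-[1+_])
open import Data.List using (List; []; _∷_; length; lookup; map; downFrom)
open import Data.List.Properties using (length-downFrom)
open import Data.List.Membership.Propositional.Properties using (∈-lookup)
open import Data.List.Relation.Unary.All as All using ()
open import Data.List.Relation.Unary.AllPairs using (_∷_)
open import Data.List.Relation.Unary.Unique.Propositional using (Unique)
open import Data.Nat using (ℕ; zero; suc; _+_; _*_; _∸_; _≤_; _<_; s≤s; z≤n; NonZero; _≡ᵇ_)
  renaming (∣_-_∣ to dist)
open import Data.Nat.Properties
  using (≤-refl; ≤-reflexive; ≤-trans; ≤-antisym; ≤-pred; ≤-total; ≤-<-trans; ≤∧≢⇒<; <-irrefl;
         m≤n⇒m≤1+n; n≤1+n; module ≤-Reasoning; +-monoʳ-≤; +-mono-≤; *-monoˡ-≤; *-identityʳ; m≤m+n;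
         +-suc; +-assoc; +-cancelʳ-≡; m+[n∸m]≡n; m∸n≤m; m∸n≡0⇒m≤n)
open import Data.Nat.DivMod
  using (_%_; _/_; m%n<n; n%n≡0; n%1≡0; %-distribˡ-+; +-distrib-/; m≡m%n+[m/n]*n)
open import Data.Nat.Divisibility using (_∣_; >⇒∤; ∣m+n∣m⇒∣n; m%n≡0⇒n∣m)
open import Data.Product using (Σ; _×_; _,_; proj₁; proj₂)
open import Function using (_∘_)
open import Data.Rational as ℚ using (ℚ; mkℚ; 0ℚ; 1ℚ; ↧ₙ_)
open import Data.Rational.Literals using (fromℤ)
import Data.Rational.Properties as ℚP
import Data.Integer.Properties as ℤP
import Data.Rational.Unnormalised as ℚᵘ
import Data.Rational.Unnormalised.Properties as ℚᵘP
open import Data.Sum using (_⊎_; inj₁; inj₂)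
open import Relation.Binary.PropositionalEquality
open import Relation.Nullary using (contradiction)
import Axiom.UniquenessOfIdentityProofs as UIP

≡ᵇ0-false⇒≢0 : ∀ n → (n ≡ᵇ 0) ≡ false → n ≢ 0
≡ᵇ0-false⇒≢0 (suc n) _ ()

≡ᵇ0-true⇒≡0 : ∀ n → (n ≡ᵇ 0) ≡ true → n ≡ 0
≡ᵇ0-true⇒≡0 zero _ = refl

∣m-n∣≤1⇒≡⊎adjacent : ∀ m n → dist m n ≤ 1 → m ≡ n ⊎ n ≡ suc m ⊎ m ≡ suc n
∣m-n∣≤1⇒≡⊎adjacent zero          zero          _        = inj₁ refl
∣m-n∣≤1⇒≡⊎adjacent zero          (suc zero)    _        = inj₂ (inj₁ refl)
∣m-n∣≤1⇒≡⊎adjacent (suc zero)    zero          _        = inj₂ (inj₂ refl)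
∣m-n∣≤1⇒≡⊎adjacent zero          (suc (suc n)) (s≤s ())
∣m-n∣≤1⇒≡⊎adjacent (suc (suc m)) zero          (s≤s ())
∣m-n∣≤1⇒≡⊎adjacent (suc m)       (suc n)       d≤1
  with ∣m-n∣≤1⇒≡⊎adjacent m n d≤1
... | inj₁ m≡n         = inj₁ (cong suc m≡n)
... | inj₂ (inj₁ n≡1+m) = inj₂ (inj₁ (cong suc n≡1+m))
... | inj₂ (inj₂ m≡1+n) = inj₂ (inj₂ (cong suc m≡1+n))

[1+m]/n≡m/n : ∀ m n .{{_ : NonZero n}} → suc m % n ≢ 0 → suc m / n ≡ m / n
[1+m]/n≡m/n m (suc zero)      ne = contradiction (n%1≡0 (suc m)) ne
[1+m]/n≡m/n m n@(suc (suc k)) ne = +-distrib-/ 1 m (s≤s m%n<1+k)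
  where
  open ≡-Reasoning
  m%n≢1+k : m % n ≢ suc k
  m%n≢1+k m%n≡1+k = ne (begin
    suc m % n        ≡⟨ %-distribˡ-+ 1 m n ⟩
    (1 + m % n) % n  ≡⟨ cong (λ r → (1 + r) % n) m%n≡1+k ⟩
    n % n            ≡⟨ n%n≡0 n ⟩
    0                ∎)
  m%n<1+k : m % n < suc k
  m%n<1+k = ≤∧≢⇒< (≤-pred (m%n<n m n)) m%n≢1+k

%-/-injective : ∀ {m n} d .{{_ : NonZero d}} → m % d ≡ n % d → m / d ≡ n / d → m ≡ n
%-/-injective {m} {n} d %≡ /≡ = begin
  m                  ≡⟨ m≡m%n+[m/n]*n m d ⟩
  m % d + m / d * d  ≡⟨ cong₂ (λ r q → r + q * d) %≡ /≡ ⟩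
  n % d + n / d * d  ≡⟨ m≡m%n+[m/n]*n n d ⟨
  n                  ∎
  where open ≡-Reasoning

∣∧<⇒≡0 : ∀ {d m} → d ∣ m → m < d → m ≡ 0
∣∧<⇒≡0 {m = zero}  _   _   = refl
∣∧<⇒≡0 {m = suc _} d∣m m<d = contradiction d∣m (>⇒∤ m<d)

∣m+n∧∣m+o∧n≤o⇒n≡o : ∀ {d} m {n o} → d ∣ m + n → d ∣ m + o → n ≤ o → o < d → n ≡ o
∣m+n∧∣m+o∧n≤o⇒n≡o {d} m {n} {o} d∣m+n d∣m+o n≤o o<d = ≤-antisym n≤o (m∸n≡0⇒m≤n o∸n≡0)
  where
  m+o≡m+n+[o∸n] : m + o ≡ m + n + (o ∸ n)
  m+o≡m+n+[o∸n] = trans (cong (m +_) (sym (m+[n∸m]≡n n≤o))) (sym (+-assoc m n (o ∸ n)))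
  o∸n≡0 : o ∸ n ≡ 0
  o∸n≡0 = ∣∧<⇒≡0 (∣m+n∣m⇒∣n (subst (d ∣_) m+o≡m+n+[o∸n] d∣m+o) d∣m+n) (≤-<-trans (m∸n≤m o n) o<d)

∣m+n∧∣m+o⇒n≡o : ∀ {d} m {n o} → d ∣ m + n → d ∣ m + o → n < d → o < d → n ≡ o
∣m+n∧∣m+o⇒n≡o m {n} {o} d∣m+n d∣m+o n<d o<d with ≤-total n o
... | inj₁ n≤o = ∣m+n∧∣m+o∧n≤o⇒n≡o m d∣m+n d∣m+o n≤o o<d
... | inj₂ o≤n = sym (∣m+n∧∣m+o∧n≤o⇒n≡o m d∣m+o d∣m+n o≤n n<d)

countᵇ : {A : Set} → (A → Bool) → List A → ℕ
countᵇ p []       = 0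
countᵇ p (x ∷ xs) with p x
... | true  = suc (countᵇ p xs)
... | false = countᵇ p xs

countᵇ-∨ : {A : Set} (p q : A → Bool) (xs : List A) →
           countᵇ (λ x → p x ∨ q x) xs ≤ countᵇ p xs + countᵇ q xs
countᵇ-∨ p q []       = z≤n
countᵇ-∨ p q (x ∷ xs) with p x | q x | countᵇ-∨ p q xs
... | true  | true  | ih = s≤s (≤-trans ih (+-monoʳ-≤ (countᵇ p xs) (n≤1+n _)))
... | true  | false | ih = s≤s ih
... | false | true  | ih = ≤-trans (s≤s ih) (≤-reflexive (sym (+-suc (countᵇ p xs) (countᵇ q xs))))
... | false | false | ih = ih

countᵇ-downFrom≡0 : ∀ (p : ℕ → Bool) n → (∀ {s} → s < n → p s ≡ false) → countᵇ p (downFrom n) ≡ 0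
countᵇ-downFrom≡0 p zero    _       = refl
countᵇ-downFrom≡0 p (suc n) p<n≡false rewrite p<n≡false ≤-refl =
  countᵇ-downFrom≡0 p n (λ s<n → p<n≡false (m≤n⇒m≤1+n s<n))

countᵇ-downFrom≤1 : ∀ (p : ℕ → Bool) n →
                    (∀ {s t} → s < n → t < n → p s ≡ true → p t ≡ true → s ≡ t) →
                    countᵇ p (downFrom n) ≤ 1
countᵇ-downFrom≤1 p zero    _       = z≤n
countᵇ-downFrom≤1 p (suc n) p-unique with p n in pn
... | true  = s≤s (≤-reflexive (countᵇ-downFrom≡0 p n below-n))
  where
  below-n : ∀ {s} → s < n → p s ≡ false
  below-n {s} s<n with p s in ps
  ... | false = refl
  ... | true  = contradiction (p-unique (m≤n⇒m≤1+n s<n) ≤-refl ps pn) (λ s≡n → <-irrefl s≡n s<n)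
... | false = countᵇ-downFrom≤1 p n (λ s<n t<n → p-unique (m≤n⇒m≤1+n s<n) (m≤n⇒m≤1+n t<n))

lookup-injective : {A : Set} (xs : List A) → Unique xs → ∀ {i j} → lookup xs i ≡ lookup xs j → i ≡ j
lookup-injective (x ∷ xs) _            {Fin.zero}  {Fin.zero}  _  = refl
lookup-injective (x ∷ xs) (x∉xs ∷ _)   {Fin.zero}  {Fin.suc j} eq =
  contradiction eq (All.lookup x∉xs (∈-lookup j))
lookup-injective (x ∷ xs) (x∉xs ∷ _)   {Fin.suc i} {Fin.zero}  eq =
  contradiction (sym eq) (All.lookup x∉xs (∈-lookup i))
lookup-injective (x ∷ xs) (_ ∷ unique) {Fin.suc i} {Fin.suc j} eq =
  cong Fin.suc (lookup-injective xs unique eq)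

module _ (G : Graph) {A : Set} (label : V G → A) (label-edge : ∀ u w → E G u w → label u ≡ label w) where

  Reach⇒label≡ : ∀ {u w} → Reach G u w → label u ≡ label w
  Reach⇒label≡ here                           = refl
  Reach⇒label≡ (step {u} {w} (inj₁ uEw) w⇝v) = trans (label-edge u w uEw) (Reach⇒label≡ w⇝v)
  Reach⇒label≡ (step {u} {w} (inj₂ wEu) w⇝v) = trans (sym (label-edge w u wEu)) (Reach⇒label≡ w⇝v)

  componentsAtMost-label-code : ∀ {t} (code : V G → Fin t) →
                                (∀ {u w} → label u ≡ label w → code u ≡ code w → u ≡ w) →
                                ComponentsAtMost t G
  componentsAtMost-label-code {t} code label-code-injective v xs unique v⇝xs =
    injective⇒≤ {f = code∘lookup} code∘lookup-injective
    where
    code∘lookup : Fin (length xs) → Fin t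
    code∘lookup i = code (lookup xs i)
    label≡ : ∀ i j → label (lookup xs i) ≡ label (lookup xs j)
    label≡ i j = trans (sym (Reach⇒label≡ (All.lookup v⇝xs (∈-lookup i))))
                       (Reach⇒label≡ (All.lookup v⇝xs (∈-lookup j)))
    code∘lookup-injective : ∀ {i j} → code∘lookup i ≡ code∘lookup j → i ≡ j
    code∘lookup-injective {i} {j} eq = lookup-injective xs unique (label-code-injective (label≡ i j) eq)

fromℕ : ℕ → ℚ
fromℕ n = fromℤ (ℤ.+ n)

1+fromℕ≡fromℕ[1+] : ∀ n → 1ℚ ℚ.+ fromℕ n ≡ fromℕ (suc n)
1+fromℕ≡fromℕ[1+] zero    = refl
1+fromℕ≡fromℕ[1+] (suc n) = ℚP.toℚᵘ-injective (ℚᵘP.≃-trans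
  (ℚP.toℚᵘ-homo-+ 1ℚ (fromℕ (suc n)))
  (ℚᵘ.*≡* (cong (λ k → ℤ.+ suc (suc k)) (*-identityʳ (n * 1)))))

fromℕ-mono-≤ : ∀ {m n} → m ≤ n → fromℕ m ℚ.≤ fromℕ n
fromℕ-mono-≤ m≤n = ℚP.toℚᵘ-cancel-≤ (ℚᵘ.*≤*
  (subst₂ ℤ._≤_ (sym (ℤP.+◃n≡+n _)) (sym (ℤP.+◃n≡+n _)) (ℤ.+≤+ (*-monoˡ-≤ 1 m≤n))))

0≤1/fromℕ : ∀ n .{{_ : NonZero n}} → 0ℚ ℚ.≤ ℚ.1/ fromℕ n
0≤1/fromℕ (suc n) = ℚP.≤ᵇ⇒≤ _

1/fromℕ≤1 : ∀ n .{{_ : NonZero n}} → ℚ.1/ fromℕ n ℚ.≤ 1ℚ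
1/fromℕ≤1 (suc n) = ℚP.≤ᵇ⇒≤ _

3*1/fromℕ[3*↧ε]≤ε : ∀ ε → 0ℚ ℚ.< ε → fromℕ 3 ℚ.* ℚ.1/ fromℕ (3 * ↧ₙ ε) ℚ.≤ ε
-- Cleared of denominators the inequality reads 3 · (1 + d) ≤ (1 + a) · (3 · (1 + d)).
3*1/fromℕ[3*↧ε]≤ε (mkℚ (ℤ.+ suc a) d _) _ = ℚP.toℚᵘ-cancel-≤ (ℚᵘP.≤-respˡ-≃
  (ℚᵘP.≃-sym (ℚP.toℚᵘ-homo-* (fromℕ 3) (ℚ.1/ fromℕ (3 * suc d))))
  (ℚᵘ.*≤* (ℤ.+≤+ (≤-trans (m≤m+n _ 0) (m≤m+n _ _)))))
3*1/fromℕ[3*↧ε]≤ε (mkℚ (ℤ.+ zero) d _) (ℚ.*<* (ℤ.+<+ ()))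
3*1/fromℕ[3*↧ε]≤ε (mkℚ -[1+ a ] d _) (ℚ.*<* ())

module _ {𝒞 : GraphClass} {G : Graph} {A : Set} (ws : A → WeightedSet 𝒞 G) {q : ℚ}
         (weight≡q : ∀ a → weight (ws a) ≡ q) where

  private
    q+n*q≡[1+n]*q : ∀ n → q ℚ.+ fromℕ n ℚ.* q ≡ fromℕ (suc n) ℚ.* q
    q+n*q≡[1+n]*q n = begin
      q ℚ.+ fromℕ n ℚ.* q            ≡⟨ cong (ℚ._+ fromℕ n ℚ.* q) (ℚP.*-identityˡ q) ⟨
      1ℚ ℚ.* q ℚ.+ fromℕ n ℚ.* q     ≡⟨ ℚP.*-distribʳ-+ q 1ℚ (fromℕ n) ⟨
      (1ℚ ℚ.+ fromℕ n) ℚ.* q         ≡⟨ cong (ℚ._* q) (1+fromℕ≡fromℕ[1+] n) ⟩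
      fromℕ (suc n) ℚ.* q            ∎
      where open ≡-Reasoning

  sumℚ-uniform : ∀ as → sumℚ (weights (map ws as)) ≡ fromℕ (length as) ℚ.* q
  sumℚ-uniform []       = sym (ℚP.*-zeroˡ q)
  sumℚ-uniform (a ∷ as) = trans (cong₂ ℚ._+_ (weight≡q a) (sumℚ-uniform as)) (q+n*q≡[1+n]*q (length as))

  load-uniform : ∀ as v → load (map ws as) v ≡ fromℕ (countᵇ (λ a → set (ws a) v) as) ℚ.* q
  load-uniform []       v = sym (ℚP.*-zeroˡ q)
  load-uniform (a ∷ as) v with set (ws a) v
  ... | true  = trans (cong₂ ℚ._+_ (weight≡q a) (load-uniform as v)) (q+n*q≡[1+n]*q _)
  ... | false = load-uniform as v

∨³-≡-false : ∀ {a b c} → a ∨ b ∨ c ≡ false → a ≡ false × b ≡ false × c ≡ false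
∨³-≡-false {false} {false} {false} refl = refl , refl , refl

─-≡ : ∀ {G : Graph} {X : VSubset G} {u w : V (G ─ X)} → proj₁ u ≡ proj₁ w → u ≡ w
─-≡ {u = v , p} {w = .v , q} refl = cong (v ,_) (UIP.Decidable⇒UIP.≡-irrelevant _≟ᵇ_ p q)

packing-mono : ∀ {𝒞 G a b} → a ℚ.≤ b → FracPacking 𝒞 G a → FracPacking 𝒞 G b
packing-mono a≤b (π , total≡1 , load≤a) = π , total≡1 , λ v → ℚP.≤-trans (load≤a v) a≤b

module Shifts (m : ℕ) .{{_ : NonZero m}} where

  cut : ℕ → ℕ → Bool
  cut s x = (x + s) % m ≡ᵇ 0

  block : ℕ → ℕ → ℕ
  block s x = (x + s) / m

  offset : ∀ {n} → ℕ → Fin n → Fin m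
  offset s i = fromℕ< (m%n<n (toℕ i + s) m)

  block-adjacent : ∀ s {x y} → dist x y ≤ 1 → cut s x ≡ false → cut s y ≡ false → block s x ≡ block s y
  block-adjacent s {x} {y} d≤1 x-kept y-kept with ∣m-n∣≤1⇒≡⊎adjacent x y d≤1
  ... | inj₁ refl        = refl
  ... | inj₂ (inj₁ refl) = sym ([1+m]/n≡m/n (x + s) m (≡ᵇ0-false⇒≢0 _ y-kept))
  ... | inj₂ (inj₂ refl) = [1+m]/n≡m/n (y + s) m (≡ᵇ0-false⇒≢0 _ x-kept)

  block-offset-injective : ∀ {n} s {i j : Fin n} →
                           block s (toℕ i) ≡ block s (toℕ j) → offset s i ≡ offset s j → i ≡ j
  block-offset-injective s {i} {j} block≡ offset≡ =
    toℕ-injective (+-cancelʳ-≡ s (toℕ i) (toℕ j) (%-/-injective m residue≡ block≡))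
    where
    residue≡ : (toℕ i + s) % m ≡ (toℕ j + s) % m
    residue≡ = trans (sym (toℕ-fromℕ< _)) (trans (cong toℕ offset≡) (toℕ-fromℕ< _))

  cut-unique : ∀ x {s t} → s < m → t < m → cut s x ≡ true → cut t x ≡ true → s ≡ t
  cut-unique x s<m t<m cut-s cut-t = ∣m+n∧∣m+o⇒n≡o x (cut⇒∣ cut-s) (cut⇒∣ cut-t) s<m t<m
    where
    cut⇒∣ : ∀ {s} → cut s x ≡ true → m ∣ x + s
    cut⇒∣ cut-s = m%n≡0⇒n∣m _ m (≡ᵇ0-true⇒≡0 _ cut-s)

  Cut : ∀ n → ℕ → VSubset (R n)
  Cut n s (i , j , k) = cut s (toℕ i) ∨ cut s (toℕ j) ∨ cut s (toℕ k)

  module _ (n s : ℕ) where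

    blocks : V (R n ─ Cut n s) → ℕ × ℕ × ℕ
    blocks ((i , j , k) , _) = block s (toℕ i) , block s (toℕ j) , block s (toℕ k)

    offsets : V (R n ─ Cut n s) → Fin (m * (m * m))
    offsets ((i , j , k) , _) = combine (offset s i) (combine (offset s j) (offset s k))

    blocks-edge : ∀ u w → E (R n ─ Cut n s) u w → blocks u ≡ blocks w
    blocks-edge (_ , u-kept) (_ , w-kept) (_ , di , dj , dk) =
      let (i-kept  , j-kept  , k-kept)  = ∨³-≡-false u-kept
          (i'-kept , j'-kept , k'-kept) = ∨³-≡-false w-kept
      in cong₂ _,_ (block-adjacent s di i-kept i'-kept)
                   (cong₂ _,_ (block-adjacent s dj j-kept j'-kept) (block-adjacent s dk k-kept k'-kept))

    blocks-offsets-injective : ∀ {u w} → blocks u ≡ blocks w → offsets u ≡ offsets w → u ≡ w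
    blocks-offsets-injective {(i , j , k) , _} {(i' , j' , k') , _} blocks≡ offsets≡ =
      let (i-offset≡ , jk-offsets≡) = combine-injective (offset s i) _ (offset s i') _ offsets≡
          (j-offset≡ , k-offset≡)   = combine-injective (offset s j) _ (offset s j') _ jk-offsets≡
      in ─-≡ {R n} {Cut n s}
           (cong₂ _,_ (block-offset-injective s (cong proj₁ blocks≡) i-offset≡)
             (cong₂ _,_ (block-offset-injective s (cong (proj₁ ∘ proj₂) blocks≡) j-offset≡)
                        (block-offset-injective s (cong (proj₂ ∘ proj₂) blocks≡) k-offset≡)))

  Chopped : GraphClass
  Chopped H = Σ ℕ λ n → Σ ℕ λ s → H ≡ R n ─ Cut n s

  Chopped∈Vs : Vs Chopped
  Chopped∈Vs = m * (m * m) , λ where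
    _ (n , s , refl) → componentsAtMost-label-code (R n ─ Cut n s) (blocks n s) (blocks-edge n s)
                                                   (offsets n s) (blocks-offsets-injective n s)

  cuts≤3 : ∀ n v → countᵇ (λ s → Cut n s v) (downFrom m) ≤ 3
  cuts≤3 n (i , j , k) = begin
    countᵇ (λ s → cut s (toℕ i) ∨ cut s (toℕ j) ∨ cut s (toℕ k)) (downFrom m)
      ≤⟨ countᵇ-∨ (cuts-of i) _ (downFrom m) ⟩
    countᵇ (cuts-of i) (downFrom m) + countᵇ (λ s → cut s (toℕ j) ∨ cut s (toℕ k)) (downFrom m)
      ≤⟨ +-monoʳ-≤ _ (countᵇ-∨ (cuts-of j) (cuts-of k) (downFrom m)) ⟩
    countᵇ (cuts-of i) (downFrom m) + (countᵇ (cuts-of j) (downFrom m) + countᵇ (cuts-of k) (downFrom m))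
      ≤⟨ +-mono-≤ (at-most-one i) (+-mono-≤ (at-most-one j) (at-most-one k)) ⟩
    3 ∎
    where
    open ≤-Reasoning
    cuts-of : Fin n → ℕ → Bool
    cuts-of x s = cut s (toℕ x)
    at-most-one : ∀ x → countᵇ (cuts-of x) (downFrom m) ≤ 1
    at-most-one x = countᵇ-downFrom≤1 (cuts-of x) m (cut-unique (toℕ x))

  weightedCut : ∀ n → ℕ → WeightedSet Chopped (R n)
  weightedCut n s = record
    { set = Cut n s ; inC = n , s , refl ; weight = ℚ.1/ fromℕ m ; w≥0 = 0≤1/fromℕ m ; w≤1 = 1/fromℕ≤1 m }

  packing : ∀ n → FracPacking Chopped (R n) (fromℕ 3 ℚ.* ℚ.1/ fromℕ m)
  packing n = map (weightedCut n) (downFrom m) , total≡1 , load≤3/m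
    where
    q : ℚ
    q = ℚ.1/ fromℕ m
    total≡1 : sumℚ (weights (map (weightedCut n) (downFrom m))) ≡ 1ℚ
    total≡1 = begin
      sumℚ (weights (map (weightedCut n) (downFrom m))) ≡⟨ sumℚ-uniform (weightedCut n) (λ _ → refl) (downFrom m) ⟩
      fromℕ (length (downFrom m)) ℚ.* q                 ≡⟨ cong (λ l → fromℕ l ℚ.* q) (length-downFrom m) ⟩
      fromℕ m ℚ.* q                                     ≡⟨ ℚP.*-inverseʳ (fromℕ m) ⟩
      1ℚ                                                ∎
      where open ≡-Reasoning
    load≤3/m : ∀ v → load (map (weightedCut n) (downFrom m)) v ℚ.≤ fromℕ 3 ℚ.* q
    load≤3/m v = ℚP.≤-trans (ℚP.≤-reflexive (load-uniform (weightedCut n) (λ _ → refl) (downFrom m) v))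
                            (ℚP.*-monoʳ-≤-nonNeg q {{ℚ.nonNegative (0≤1/fromℕ m)}} (fromℕ-mono-≤ (cuts≤3 n v)))

lemma9 : FractionallyFragile Vs ℛ
lemma9 ε ε>0 = Chopped , Chopped∈Vs , λ where
    _ (n , _ , refl) → packing-mono (3*1/fromℕ[3*↧ε]≤ε ε ε>0) (packing n)
  where open Shifts (3 * ↧ₙ ε)
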